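{- Let $t_n=(-1)^{s_2(n)}$, $h_0=0$, $h_1=1$, and $h_n=t_nh_{n-1}+h_{n-2}$ for $n\ge2$. Then: (1) The set $\{n\in\mathbb{N}: h_{n+i}<0 \text{ for } i=0,1,2,3,4\}$ is infinite. (2) There is no $n\in\mathbb{N}$ with $h_{n+i}<0$ for $i=0,\ldots,5$. (3) There is no $n\in\mathbb{N}$ with $h_{n+i}>0$ for $i=0,1,2$.
   Context: $s_2(n)$ denotes the number of 1's in the binary expansion of $n$; $(t_n)$ is the Prouhet–Thue–Morse sequence. -}

module Defs where

open import Data.Nat using (ℕ; zero; suc; _+_; _%_; ⌊_/2⌋)
open import Data.Integer using (ℤ; +_; -_; _*_) renaming (_+_ to _+ℤ_)

-- number of 1's in the binary expansion, computed with fuel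
-- (fuel n suffices, since n has at most n binary digits)
s₂-fuel : ℕ → ℕ → ℕ
s₂-fuel zero    n = 0
s₂-fuel (suc f) n = n % 2 + s₂-fuel f ⌊ n /2⌋

s₂ : ℕ → ℕ
s₂ n = s₂-fuel n n

neg1^ : ℕ → ℤ
neg1^ zero    = + 1
neg1^ (suc k) = - neg1^ k

t : ℕ → ℤ
t n = neg1^ (s₂ n)

h : ℕ → ℤ
h zero = + 0
h (suc zero) = + 1
h (suc (suc n)) = t (suc (suc n)) * h (suc n) +ℤ h n

module Submission where

-- Since t (4m + r) = t m · (1, -1, -1, 1), the recurrence over one block reads, with
-- a = h (4m-2), b = h (4m-1) and ε = t m,
--   h (4m) = a + εb,  h (4m+1) = -εa,  h (4m+2) = 2a + εb,  h (4m+3) = εa + b.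
-- So a < -∣b∣ passes from block to block: h is negative at every even index ≥ 2, and
-- h (4m+1), h (4m+3) have the signs of t m and -t m. This rules out three positive or six
-- negative consecutive terms, and wherever t m = 1, t (m+1) = -1 (e.g. m = 2l with t l = 1)
-- the five terms h (4m+2), …, h (4m+6) are negative.

module SignedRecurrence where
  open import Data.Integer using (ℤ; +_; -_; _+_; _-_; _*_; _<_; 0ℤ)
  open import Data.Integer.Properties using (+-mono-<; neg-mono-<; *-cancelˡ-<-nonNeg; module ≤-Reasoning)
  open import Data.Integer.Tactic.RingSolver using (solve)
  open import Data.List using (_∷_; [])
  open import Data.Product using (_×_; _,_)
  open import Relation.Binary.PropositionalEquality using (_≡_; refl; sym; subst)

  Dominant : ℤ → ℤ → Set
  Dominant a b = a + b < 0ℤ × a - b < 0ℤ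

  dominant⇒negative : ∀ {a b} → Dominant a b → a < 0ℤ
  dominant⇒negative {a} {b} (a+b<0 , a-b<0) = *-cancelˡ-<-nonNeg (+ 2) (begin-strict
    + 2 * a           ≡⟨ solve (a ∷ b ∷ []) ⟩
    (a + b) + (a - b) <⟨ +-mono-< a+b<0 a-b<0 ⟩
    0ℤ                ∎)
    where open ≤-Reasoning

  -- Four terms of xₙ = εₙ xₙ₋₁ + xₙ₋₂ following a, b, with εₙ = ε, -ε, -ε, ε:
  -- the pattern of t on 4m, …, 4m+3, where ε = t m.
  record Block (ε a b y₀ y₁ y₂ y₃ : ℤ) : Set where
    field
      step₀ : y₀ ≡ ε * b + a
      step₁ : y₁ ≡ - ε * y₀ + b
      step₂ : y₂ ≡ - ε * y₁ + y₀
      step₃ : y₃ ≡ ε * y₂ + y₁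

  module _ {a b y₀ y₁ y₂ y₃ : ℤ} where

    block⁺-closed : Block (+ 1) a b y₀ y₁ y₂ y₃ →
      y₀ ≡ a + b × y₁ ≡ - a × y₃ ≡ a + b × y₂ + y₃ ≡ a + ((a + b) + (a + b)) × y₂ - y₃ ≡ a
    block⁺-closed record { step₀ = refl ; step₁ = refl ; step₂ = refl ; step₃ = refl } =
      solve (a ∷ b ∷ []) , solve (a ∷ b ∷ []) , solve (a ∷ b ∷ []) , solve (a ∷ b ∷ []) , solve (a ∷ b ∷ [])

    block⁻-closed : Block (- + 1) a b y₀ y₁ y₂ y₃ →
      y₀ ≡ a - b × y₁ ≡ a × y₃ ≡ - (a - b) × y₂ + y₃ ≡ a × y₂ - y₃ ≡ a + ((a - b) + (a - b))
    block⁻-closed record { step₀ = refl ; step₁ = refl ; step₂ = refl ; step₃ = refl } =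
      solve (a ∷ b ∷ []) , solve (a ∷ b ∷ []) , solve (a ∷ b ∷ []) , solve (a ∷ b ∷ []) , solve (a ∷ b ∷ [])

    block⁺ : Block (+ 1) a b y₀ y₁ y₂ y₃ → Dominant a b →
      y₀ < 0ℤ × 0ℤ < y₁ × y₃ < 0ℤ × Dominant y₂ y₃
    block⁺ blk dom@(a+b<0 , _) with block⁺-closed blk
    ... | refl , refl , refl , sum≡ , diff≡ =
      a+b<0 , neg-mono-< a<0 , a+b<0 ,
      subst (_< 0ℤ) (sym sum≡) (+-mono-< a<0 (+-mono-< a+b<0 a+b<0)) ,
      subst (_< 0ℤ) (sym diff≡) a<0
      where a<0 = dominant⇒negative dom

    block⁻ : Block (- + 1) a b y₀ y₁ y₂ y₃ → Dominant a b →
      y₀ < 0ℤ × y₁ < 0ℤ × 0ℤ < y₃ × Dominant y₂ y₃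
    block⁻ blk dom@(_ , a-b<0) with block⁻-closed blk
    ... | refl , refl , refl , sum≡ , diff≡ =
      a-b<0 , a<0 , neg-mono-< a-b<0 ,
      subst (_< 0ℤ) (sym sum≡) a<0 ,
      subst (_< 0ℤ) (sym diff≡) (+-mono-< a<0 (+-mono-< a-b<0 a-b<0))
      where a<0 = dominant⇒negative dom

open SignedRecurrence

open import Defs
open import Data.Nat using (ℕ; zero; suc; _+_; _*_; _≤_; _<_; _%_; _/_; ⌊_/2⌋; z≤n; s≤s⁻¹; z<s; s<s)
open import Data.Nat.Properties
  using (+-comm; +-assoc; *-assoc; ⌊n/2⌋<n; ≤-refl; ≤-trans; n≤1+n; m≤m*n; m≤n+m)
open import Data.Nat.DivMod using (m*n%n≡0; [m+kn]%n≡m%n; m≡m%n+[m/n]*n; m%n<n)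
open import Data.Integer as ℤ using (ℤ; +_; -_; 0ℤ; +<+) renaming (_<_ to _<ℤ_; _≤_ to _≤ℤ_)
open import Data.Integer.Properties using (neg-involutive; <-asym; <⇒≤; <⇒≱)
open import Data.Product using (_×_; _,_; proj₁; proj₂; ∃-syntax)
open import Data.Sum using (_⊎_; inj₁; inj₂; [_,_]′)
open import Data.Empty using (⊥)
open import Relation.Nullary using (¬_)
open import Relation.Binary.PropositionalEquality using (_≡_; refl; sym; trans; cong; cong₂; subst; module ≡-Reasoning)

s₂-fuel-zero : ∀ f → s₂-fuel f 0 ≡ 0
s₂-fuel-zero zero    = refl
s₂-fuel-zero (suc f) = s₂-fuel-zero f

n≤1+f⇒⌊n/2⌋≤f : ∀ {n f} → n ≤ suc f → ⌊ n /2⌋ ≤ f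
n≤1+f⇒⌊n/2⌋≤f {zero}  _   = z≤n
n≤1+f⇒⌊n/2⌋≤f {suc n} n≤f = s≤s⁻¹ (≤-trans (⌊n/2⌋<n n) n≤f)

s₂-fuel-irrelevant : ∀ {f g n} → n ≤ f → n ≤ g → s₂-fuel f n ≡ s₂-fuel g n
s₂-fuel-irrelevant {zero}  {g}     z≤n _   = sym (s₂-fuel-zero g)
s₂-fuel-irrelevant {suc f} {zero}  _   z≤n = s₂-fuel-zero (suc f)
s₂-fuel-irrelevant {suc f} {suc g} {n} n≤f n≤g =
  cong (_+_ (n % 2)) (s₂-fuel-irrelevant (n≤1+f⇒⌊n/2⌋≤f n≤f) (n≤1+f⇒⌊n/2⌋≤f n≤g))

s₂-rec : ∀ n → s₂ n ≡ n % 2 + s₂ ⌊ n /2⌋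
s₂-rec zero    = refl
s₂-rec (suc n) = cong (_+_ (suc n % 2)) (s₂-fuel-irrelevant (s≤s⁻¹ (⌊n/2⌋<n n)) ≤-refl)

⌊n*2/2⌋≡n : ∀ n → ⌊ n * 2 /2⌋ ≡ n
⌊n*2/2⌋≡n zero    = refl
⌊n*2/2⌋≡n (suc n) = cong suc (⌊n*2/2⌋≡n n)

⌊1+n*2/2⌋≡n : ∀ n → ⌊ 1 + n * 2 /2⌋ ≡ n
⌊1+n*2/2⌋≡n zero    = refl
⌊1+n*2/2⌋≡n (suc n) = cong suc (⌊1+n*2/2⌋≡n n)

s₂-double : ∀ n → s₂ (n * 2) ≡ s₂ n
s₂-double n = trans (s₂-rec (n * 2)) (cong₂ _+_ (m*n%n≡0 n 2) (cong s₂ (⌊n*2/2⌋≡n n)))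

s₂-double+1 : ∀ n → s₂ (1 + n * 2) ≡ suc (s₂ n)
s₂-double+1 n =
  trans (s₂-rec (1 + n * 2)) (cong₂ _+_ ([m+kn]%n≡m%n 1 n 2) (cong s₂ (⌊1+n*2/2⌋≡n n)))

t-double : ∀ n → t (n * 2) ≡ t n
t-double n = cong neg1^ (s₂-double n)

t-double+1 : ∀ n → t (1 + n * 2) ≡ - t n
t-double+1 n = cong neg1^ (s₂-double+1 n)

t-unit : ∀ n → t n ≡ + 1 ⊎ t n ≡ - + 1
t-unit n = neg1^-unit (s₂ n)
  where
  neg1^-unit : ∀ k → neg1^ k ≡ + 1 ⊎ neg1^ k ≡ - + 1
  neg1^-unit zero = inj₁ refl
  neg1^-unit (suc k) with neg1^-unit k
  ... | inj₁ e = inj₂ (cong -_ e)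
  ... | inj₂ e = inj₁ (cong -_ e)

t-quad : ∀ m → t (m * 4) ≡ t m × t (1 + m * 4) ≡ - t m × t (2 + m * 4) ≡ - t m × t (3 + m * 4) ≡ t m
t-quad m rewrite sym (*-assoc m 2 2) =
  trans (t-double (m * 2)) (t-double m) ,
  trans (t-double+1 (m * 2)) (cong -_ (t-double m)) ,
  trans (t-double (1 + m * 2)) (t-double+1 m) ,
  trans (t-double+1 (1 + m * 2)) (trans (cong -_ (t-double+1 m)) (neg-involutive (t m)))

t≡1-unbounded : ∀ m → ∃[ l ] (m ≤ l × t (suc l) ≡ + 1)
t≡1-unbounded m with t-unit (suc m)
... | inj₁ e = m , ≤-refl , e
... | inj₂ e = suc m * 2 , ≤-trans (m≤m*n m 2) (≤-trans (n≤1+n _) (n≤1+n _)) ,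
               trans (t-double+1 (suc m)) (cong -_ e)

t-sign-change : ∀ m → ∃[ j ] (m ≤ j × t (1 + j) ≡ + 1 × t (2 + j) ≡ - + 1)
t-sign-change m with t≡1-unbounded m
... | l , m≤l , e = 1 + l * 2 , ≤-trans m≤l (≤-trans (m≤m*n l 2) (n≤1+n _)) ,
                    trans (t-double (suc l)) e , trans (t-double+1 (suc l)) (cong -_ e)

h-block : ∀ j {ε} → t (suc j) ≡ ε →
  Block ε (h (2 + j * 4)) (h (3 + j * 4)) (h (4 + j * 4)) (h (5 + j * 4)) (h (6 + j * 4)) (h (7 + j * 4))
h-block j refl =
  let (t₀ , t₁ , t₂ , t₃) = t-quad (suc j) in record
    { step₀ = cong (λ ε → ε ℤ.* h (3 + j * 4) ℤ.+ h (2 + j * 4)) t₀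
    ; step₁ = cong (λ ε → ε ℤ.* h (4 + j * 4) ℤ.+ h (3 + j * 4)) t₁
    ; step₂ = cong (λ ε → ε ℤ.* h (5 + j * 4) ℤ.+ h (4 + j * 4)) t₂
    ; step₃ = cong (λ ε → ε ℤ.* h (6 + j * 4) ℤ.+ h (5 + j * 4)) t₃
    }

h-dominant : ∀ j → Dominant (h (2 + j * 4)) (h (3 + j * 4))
h-dominant zero = ℤ.-<+ , ℤ.-<+    -- h 2 = -1, h 3 = 0
h-dominant (suc j) with t-unit (suc j)
... | inj₁ e = proj₂ (proj₂ (proj₂ (block⁺ (h-block j e) (h-dominant j))))
... | inj₂ e = proj₂ (proj₂ (proj₂ (block⁻ (h-block j e) (h-dominant j))))

h[2+k*4]<0 : ∀ k → h (2 + k * 4) <ℤ 0ℤ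
h[2+k*4]<0 k = dominant⇒negative (h-dominant k)

h[4+k*4]<0 : ∀ k → h (4 + k * 4) <ℤ 0ℤ
h[4+k*4]<0 k with t-unit (suc k)
... | inj₁ e = proj₁ (block⁺ (h-block k e) (h-dominant k))
... | inj₂ e = proj₁ (block⁻ (h-block k e) (h-dominant k))

h[k*4]≤0 : ∀ k → h (k * 4) ≤ℤ 0ℤ
h[k*4]≤0 zero    = ℤ.+≤+ z≤n
h[k*4]≤0 (suc k) = <⇒≤ (h[4+k*4]<0 k)

h-odd-signs⁺ : ∀ k → t (suc k) ≡ + 1 → 0ℤ <ℤ h (5 + k * 4) × h (7 + k * 4) <ℤ 0ℤ
h-odd-signs⁺ k e = let (_ , y₁>0 , y₃<0 , _) = block⁺ (h-block k e) (h-dominant k) in y₁>0 , y₃<0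

h-odd-signs⁻ : ∀ k → t (suc k) ≡ - + 1 → h (5 + k * 4) <ℤ 0ℤ × 0ℤ <ℤ h (7 + k * 4)
h-odd-signs⁻ k e = let (_ , y₁<0 , y₃>0 , _) = block⁻ (h-block k e) (h-dominant k) in y₁<0 , y₃>0

h[1+k*4]>0⊎h[3+k*4]>0 : ∀ k → 0ℤ <ℤ h (1 + k * 4) ⊎ 0ℤ <ℤ h (3 + k * 4)
h[1+k*4]>0⊎h[3+k*4]>0 zero = inj₁ (+<+ z<s)
h[1+k*4]>0⊎h[3+k*4]>0 (suc k) with t-unit (suc k)
... | inj₁ e = inj₁ (proj₁ (h-odd-signs⁺ k e))
... | inj₂ e = inj₂ (proj₂ (h-odd-signs⁻ k e))

-- With i and r literals, i + r + q * 4 reduces to a literal plus q * 4.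
mod4-window : ∀ n → ∃[ q ] ∃[ r ] (r < 4 × ∀ i → n + i ≡ i + r + q * 4)
mod4-window n = n / 4 , n % 4 , m%n<n n 4 , λ i → begin
  n + i                   ≡⟨ +-comm n i ⟩
  i + n                   ≡⟨ cong (_+_ i) (m≡m%n+[m/n]*n n 4) ⟩
  i + (n % 4 + n / 4 * 4) ≡⟨ sym (+-assoc i (n % 4) (n / 4 * 4)) ⟩
  i + n % 4 + n / 4 * 4   ∎
  where open ≡-Reasoning

five-negatives : ∀ j → t (1 + j) ≡ + 1 → t (2 + j) ≡ - + 1 → ∀ i → i < 5 → h (i + (6 + j * 4)) <ℤ 0ℤ
five-negatives j _  _  0 _ = h[2+k*4]<0 (suc j)
five-negatives j t⁺ _  1 _ = proj₂ (h-odd-signs⁺ j t⁺)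
five-negatives j _  _  2 _ = h[4+k*4]<0 (suc j)
five-negatives j _  t⁻ 3 _ = proj₁ (h-odd-signs⁻ (suc j) t⁻)
five-negatives j _  _  4 _ = h[2+k*4]<0 (suc (suc j))
five-negatives j _  _  (suc (suc (suc (suc (suc _))))) (s<s (s<s (s<s (s<s (s<s ())))))

five-negatives-unbounded : (m : ℕ) → ∃[ n ] (m ≤ n × ((i : ℕ) → i < 5 → h (n + i) <ℤ 0ℤ))
five-negatives-unbounded m with t-sign-change m
... | j , m≤j , t⁺ , t⁻ =
  6 + j * 4 ,
  ≤-trans m≤j (≤-trans (m≤m*n j 4) (m≤n+m (j * 4) 6)) ,
  λ i i<5 → subst (λ x → h x <ℤ 0ℤ) (+-comm i (6 + j * 4)) (five-negatives j t⁺ t⁻ i i<5)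

no-six-negatives : ¬ (∃[ n ] ((i : ℕ) → i < 6 → h (n + i) <ℤ 0ℤ))
no-six-negatives (n , neg) with mod4-window n
... | q , r , r<4 , shift = excluded r r<4 (λ i i<6 → subst (λ x → h x <ℤ 0ℤ) (shift i) (neg i i<6))
  where
  not-both-negative : ∀ {x y} → 0ℤ <ℤ x ⊎ 0ℤ <ℤ y → x <ℤ 0ℤ → y <ℤ 0ℤ → ⊥
  not-both-negative pos x<0 y<0 = [ <-asym x<0 , <-asym y<0 ]′ pos
  excluded : ∀ r → r < 4 → (∀ i → i < 6 → h (i + r + q * 4) <ℤ 0ℤ) → ⊥
  excluded 0 _ neg = not-both-negative (h[1+k*4]>0⊎h[3+k*4]>0 q)
    (neg 1 (s<s z<s)) (neg 3 (s<s (s<s (s<s z<s))))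
  excluded 1 _ neg = not-both-negative (h[1+k*4]>0⊎h[3+k*4]>0 q)
    (neg 0 z<s) (neg 2 (s<s (s<s z<s)))
  excluded 2 _ neg = not-both-negative (h[1+k*4]>0⊎h[3+k*4]>0 (suc q))
    (neg 3 (s<s (s<s (s<s z<s)))) (neg 5 (s<s (s<s (s<s (s<s (s<s z<s))))))
  excluded 3 _ neg = not-both-negative (h[1+k*4]>0⊎h[3+k*4]>0 (suc q))
    (neg 2 (s<s (s<s z<s))) (neg 4 (s<s (s<s (s<s (s<s z<s)))))
  excluded (suc (suc (suc (suc _)))) (s<s (s<s (s<s (s<s ())))) _

no-three-positives : ¬ (∃[ n ] ((i : ℕ) → i < 3 → 0ℤ <ℤ h (n + i)))
no-three-positives (n , pos) with mod4-window n
... | q , r , r<4 , shift = excluded r r<4 (λ i i<3 → subst (λ x → 0ℤ <ℤ h x) (shift i) (pos i i<3))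
  where
  excluded : ∀ r → r < 4 → (∀ i → i < 3 → 0ℤ <ℤ h (i + r + q * 4)) → ⊥
  excluded 0 _ pos = <⇒≱ (pos 0 z<s) (h[k*4]≤0 q)
  excluded 1 _ pos = <-asym (h[2+k*4]<0 q) (pos 1 (s<s z<s))
  excluded 2 _ pos = <-asym (h[2+k*4]<0 q) (pos 0 z<s)
  excluded 3 _ pos = <-asym (h[4+k*4]<0 q) (pos 1 (s<s z<s))
  excluded (suc (suc (suc (suc _)))) (s<s (s<s (s<s (s<s ())))) _

corollary2 : ((m : ℕ) → ∃[ n ] (m ≤ n × ((i : ℕ) → i < 5 → h (n + i) <ℤ + 0)))
    × (¬ (∃[ n ] ((i : ℕ) → i < 6 → h (n + i) <ℤ + 0)))
    × (¬ (∃[ n ] ((i : ℕ) → i < 3 → + 0 <ℤ h (n + i))))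
corollary2 = five-negatives-unbounded , no-six-negatives , no-three-positives
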